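{- Let $Q=(I_n,*)$ be a binary quasigroup of order $n$. Let $d\ge 2$ and let $H_d$ and $H_{d-1}$ be Latin hypercubes of order $n$ on $I_n$ of dimensions $d$ and $d-1$ respectively, related by $H_d(x_1,\dots,x_d)=H_{d-1}(x_1,\dots,x_{d-1})*x_d$ for all $x_1,\dots,x_d\in I_n$. Then: (1) If every entry of $H_{d-1}$ lies in a constant diagonal (respectively, the entries of $H_{d-1}$ can be partitioned into constant diagonals), then every entry of $H_d$ lies in a transversal (respectively, the entries of $H_d$ can be partitioned into transversals). (2) If every entry of $H_{d-1}$ lies in a transversal (respectively, the entries of $H_{d-1}$ can be partitioned into transversals), then every entry of $H_d$ lies in a constant diagonal (respectively, the entries of $H_d$ can be partitioned into constant diagonals).
   Context: $I_n$ is a set of size $n$. A $k$-dimensional hypercube of order $n$ is a map $H:I_n^k\to I_n$ with entries $(x_1,\dots,x_k;H(x_1,\dots,x_k))$. A line is obtained by fixing all but one coordinate; $H$ is Latin if every line contains every element of $I_n$ as a symbol (for $k=1$ this means $H$ is a bijection). A diagonal is a set of $n$ entries no two of which agree in any coordinate; it is constant if all its entries have the same symbol, and it is a transversal if its entries have pairwise distinct symbols. -}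

module Defs where

open import Data.Nat using (ℕ)
open import Data.Fin using (Fin)
open import Data.Vec using (Vec; lookup; _[_]≔_)
open import Data.Product using (Σ; ∃; ∃₂; _×_)
open import Relation.Binary.PropositionalEquality using (_≡_; _≢_)

Point : ℕ → ℕ → Set
Point n k = Vec (Fin n) k

Hypercube : ℕ → ℕ → Set
Hypercube n k = Point n k → Fin n

IsLatin : ∀ {n k} → Hypercube n k → Set
IsLatin {n} {k} H = (x : Point n k) (c : Fin k) (s : Fin n) → ∃ λ v → H (x [ c ]≔ v) ≡ s

IsQuasigroup : ∀ {n} → (Fin n → Fin n → Fin n) → Set
IsQuasigroup {n} _*_ =
  ((a b : Fin n) → ∃ λ x → (a * x ≡ b) × ((x' : Fin n) → a * x' ≡ b → x' ≡ x)) ×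
  ((a b : Fin n) → ∃ λ y → (y * a ≡ b) × ((y' : Fin n) → y' * a ≡ b → y' ≡ y))

-- A diagonal: n cells (indexed by Fin n) no two of which agree in any coordinate.
-- (Distinct indices give distinct cells; for k ≥ 1 this is a set of n cells.)
IsDiagonal : ∀ {n k} → (Fin n → Point n k) → Set
IsDiagonal {n} {k} D = (i j : Fin n) (c : Fin k) → i ≢ j → lookup (D i) c ≢ lookup (D j) c

IsConstantDiagonal : ∀ {n k} → Hypercube n k → (Fin n → Point n k) → Set
IsConstantDiagonal {n} H D = IsDiagonal D × ((i j : Fin n) → H (D i) ≡ H (D j))

IsTransversal : ∀ {n k} → Hypercube n k → (Fin n → Point n k) → Set
IsTransversal {n} H D = IsDiagonal D × ((i j : Fin n) → i ≢ j → H (D i) ≢ H (D j))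

EveryEntryIn : ∀ {n k} → ((Fin n → Point n k) → Set) → Set
EveryEntryIn {n} {k} P = (x : Point n k) → ∃ λ D → P D × ∃ λ i → D i ≡ x

PartitionInto : ∀ {n k} → ((Fin n → Point n k) → Set) → Set
PartitionInto {n} {k} P =
  Σ ℕ λ m → Σ (Fin m → Fin n → Point n k) λ D →
    ((j : Fin m) → P (D j)) ×
    ((x : Point n k) → ∃₂ λ j i → D j i ≡ x) ×
    ((j j' : Fin m) (i i' : Fin n) → D j i ≡ D j' i' → (j ≡ j') × (i ≡ i'))

-- A diagonal D of H_{d-1} is lifted to H_d by appending last coordinates that depend
-- injectively on the index i. If D is constant with symbol c, append i ∙ r: the lifted
-- symbols c ∙ (i ∙ r) are pairwise distinct. If D is a transversal with symbols a_i,
-- append a_i \\ r: every lifted symbol is r, and a_i \\ r is injective in i because the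
-- a_i are distinct. For each cell D i the last coordinate is a bijective function of r,
-- so the n lifts of D (one per r) partition the cells of H_d lying above D; this yields
-- both the covering and the partition statements.
module Submission where

open import Defs
open import Data.Nat using (ℕ; suc; _≤_; _*_)
open import Data.Fin using (Fin; zero; suc; _≟_)
open import Data.Fin.Properties using (*↔×)
open import Data.Vec using (Vec; []; _∷_; _∷ʳ_; lookup; initLast)
open import Data.Vec.Properties using (∷ʳ-injective)
open import Data.Product using (_×_; _,_; proj₁; proj₂; ∃)
import Data.Product as Product
open import Data.Sum using (_⊎_; inj₁; inj₂)
import Data.Sum as Sum
open import Function using (_∘_; id)
open import Function.Bundles using (Inverse; Injection)
open import Function.Properties.Inverse using (↔⇒↣)
open import Function.Definitions using (Injective; StrictlySurjective)
open import Relation.Nullary.Decidable using (decidable-stable)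
open import Relation.Binary.PropositionalEquality
  using (_≡_; refl; sym; trans; cong; module ≡-Reasoning)

module QuasigroupProperties {n} {_∙_ : Fin n → Fin n → Fin n} (Q : IsQuasigroup _∙_) where

  _\\_ : Fin n → Fin n → Fin n
  a \\ b = proj₁ (proj₁ Q a b)

  ∙-\\ : ∀ a b → a ∙ (a \\ b) ≡ b
  ∙-\\ a b = proj₁ (proj₂ (proj₁ Q a b))

  \\-unique : ∀ {a b x} → a ∙ x ≡ b → x ≡ a \\ b
  \\-unique {a} {b} {x} = proj₂ (proj₂ (proj₁ Q a b)) x

  ∙-cancelˡ : ∀ a → Injective _≡_ _≡_ (a ∙_)
  ∙-cancelˡ a {x} {y} e = trans (\\-unique refl) (sym (\\-unique (sym e)))

  ∙-cancelʳ : ∀ a → Injective _≡_ _≡_ (_∙ a)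
  ∙-cancelʳ a {x} {y} e = trans (unique x refl) (sym (unique y (sym e)))
    where
      unique : ∀ z → z ∙ a ≡ x ∙ a → z ≡ proj₁ (proj₂ Q a (x ∙ a))
      unique = proj₂ (proj₂ (proj₂ Q a (x ∙ a)))

  \\-injective : ∀ a → Injective _≡_ _≡_ (a \\_)
  \\-injective a {b} {b'} e = begin
    b            ≡⟨ ∙-\\ a b ⟨
    a ∙ (a \\ b)  ≡⟨ cong (a ∙_) e ⟩
    a ∙ (a \\ b') ≡⟨ ∙-\\ a b' ⟩
    b'           ∎
    where open ≡-Reasoning

  \\-injectiveˡ : ∀ b → Injective _≡_ _≡_ (_\\ b)
  \\-injectiveˡ b {a} {a'} e = ∙-cancelʳ (a \\ b) (trans (∙-\\ a b) (sym (begin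
    a' ∙ (a \\ b)  ≡⟨ cong (a' ∙_) e ⟩
    a' ∙ (a' \\ b) ≡⟨ ∙-\\ a' b ⟩
    b             ∎)))
    where open ≡-Reasoning

lookup-∷ʳ-agree : ∀ {A : Set} {k} (xs ys : Vec A k) {x y : A} (c : Fin (suc k)) →
  lookup (xs ∷ʳ x) c ≡ lookup (ys ∷ʳ y) c → (∃ λ c' → lookup xs c' ≡ lookup ys c') ⊎ x ≡ y
lookup-∷ʳ-agree []       []       zero    e = inj₂ e
lookup-∷ʳ-agree (_ ∷ xs) (_ ∷ ys) zero    e = inj₁ (zero , e)
lookup-∷ʳ-agree (_ ∷ xs) (_ ∷ ys) (suc c) e = Sum.map₁ (Product.map suc id) (lookup-∷ʳ-agree xs ys c e)

∷ʳ-isDiagonal : ∀ {n k} {D : Fin n → Point n k} {f : Fin n → Fin n} →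
  IsDiagonal D → Injective _≡_ _≡_ f → IsDiagonal (λ i → D i ∷ʳ f i)
∷ʳ-isDiagonal {D = D} diagonal f-injective i j c i≢j e with lookup-∷ʳ-agree (D i) (D j) c e
... | inj₁ (c' , e') = diagonal i j c' i≢j e'
... | inj₂ e'        = i≢j (f-injective e')

transversal-symbols-injective : ∀ {n k} {H : Hypercube n k} {D : Fin n → Point n k} →
  IsTransversal H D → Injective _≡_ _≡_ (H ∘ D)
transversal-symbols-injective (_ , distinct) {i} {j} e =
  decidable-stable (i ≟ j) (λ i≢j → distinct i j i≢j e)

record Lifting {n k} (P : (Fin n → Point n k) → Set) (P' : (Fin n → Point n (suc k)) → Set) : Set where
  field
    lastCoord            : (Fin n → Point n k) → Fin n → Fin n → Fin n
    lift-preserves       : ∀ {D} → P D → ∀ r → P' (λ i → D i ∷ʳ lastCoord D r i)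
    lastCoord-injective  : ∀ {D} → P D → ∀ i → Injective _≡_ _≡_ (λ r → lastCoord D r i)
    lastCoord-surjective : ∀ {D} → P D → ∀ i → StrictlySurjective _≡_ (λ r → lastCoord D r i)

module _ {n k} {P : (Fin n → Point n k) → Set} {P' : (Fin n → Point n (suc k)) → Set}
         (L : Lifting P P') where

  open Lifting L

  lift-everyEntryIn : EveryEntryIn P → EveryEntryIn P'
  lift-everyEntryIn covered xy with initLast xy
  ... | x , y , refl with covered x
  ... | D , PD , i , refl with lastCoord-surjective PD i y
  ... | r , e = (λ j → D j ∷ʳ lastCoord D r j) , lift-preserves PD r , i , cong (D i ∷ʳ_) e

  lift-partitionInto : PartitionInto P → PartitionInto P'
  lift-partitionInto (m , D , PD , cover , disjoint) = m * n , D' , PD' , cover' , disjoint'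
    where
      open Inverse (*↔× {m} {n}) using (to; from; strictlyInverseˡ)

      lifted : Fin m × Fin n → Fin n → Point n (suc k)
      lifted (j , r) i = D j i ∷ʳ lastCoord (D j) r i

      D' : Fin (m * n) → Fin n → Point n (suc k)
      D' = lifted ∘ to

      PD' : ∀ t → P' (D' t)
      PD' t = lift-preserves (PD (proj₁ (to t))) (proj₂ (to t))

      cover' : ∀ xy → ∃ λ t → ∃ λ i → D' t i ≡ xy
      cover' xy with initLast xy
      ... | x , y , refl with cover x
      ... | j , i , refl with lastCoord-surjective (PD j) i y
      ... | r , e = from (j , r) , i , trans (cong (λ jr → lifted jr i) (strictlyInverseˡ (j , r)))
                                             (cong (D j i ∷ʳ_) e)

      lifted-disjoint : ∀ jr jr' i i' → lifted jr i ≡ lifted jr' i' → (jr ≡ jr') × (i ≡ i')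
      lifted-disjoint (j , r) (j' , r') i i' e with ∷ʳ-injective (D j i) (D j' i') e
      ... | e₁ , e₂ with disjoint j j' i i' e₁
      ... | refl , refl = cong (j ,_) (lastCoord-injective (PD j) i e₂) , refl

      to-injective : Injective _≡_ _≡_ to
      to-injective = Injection.injective (↔⇒↣ (*↔× {m} {n}))

      disjoint' : ∀ t t' i i' → D' t i ≡ D' t' i' → (t ≡ t') × (i ≡ i')
      disjoint' t t' i i' e = Product.map₁ to-injective (lifted-disjoint (to t) (to t') i i' e)

module _ {n k} {_∙_ : Fin n → Fin n → Fin n} (Q : IsQuasigroup _∙_)
         (Hd : Hypercube n (suc k)) (Hd1 : Hypercube n k)
         (Hd≡Hd1∙last : (x : Point n k) (y : Fin n) → Hd (x ∷ʳ y) ≡ Hd1 x ∙ y) where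

  open QuasigroupProperties Q

  constantDiagonal⇒transversal : Lifting (IsConstantDiagonal Hd1) (IsTransversal Hd)
  constantDiagonal⇒transversal = record
    { lastCoord            = λ _ r i → i ∙ r
    ; lift-preserves       = preserves
    ; lastCoord-injective  = λ _ i → ∙-cancelˡ i
    ; lastCoord-surjective = λ _ i y → i \\ y , ∙-\\ i y
    }
    where
      preserves : ∀ {D} → IsConstantDiagonal Hd1 D → ∀ r → IsTransversal Hd (λ i → D i ∷ʳ (i ∙ r))
      preserves {D} (diagonal , constant) r =
        ∷ʳ-isDiagonal {D = D} diagonal (∙-cancelʳ r) ,
        λ i j i≢j e → i≢j (∙-cancelʳ r (∙-cancelˡ (Hd1 (D i)) (begin
          Hd1 (D i) ∙ (i ∙ r) ≡⟨ Hd≡Hd1∙last (D i) (i ∙ r) ⟨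
          Hd (D i ∷ʳ (i ∙ r)) ≡⟨ e ⟩
          Hd (D j ∷ʳ (j ∙ r)) ≡⟨ Hd≡Hd1∙last (D j) (j ∙ r) ⟩
          Hd1 (D j) ∙ (j ∙ r) ≡⟨ cong (_∙ (j ∙ r)) (constant j i) ⟩
          Hd1 (D i) ∙ (j ∙ r) ∎)))
        where open ≡-Reasoning

  transversal⇒constantDiagonal : Lifting (IsTransversal Hd1) (IsConstantDiagonal Hd)
  transversal⇒constantDiagonal = record
    { lastCoord            = λ D r i → Hd1 (D i) \\ r
    ; lift-preserves       = preserves
    ; lastCoord-injective  = λ {D} _ i → \\-injective (Hd1 (D i))
    ; lastCoord-surjective = λ {D} _ i y → Hd1 (D i) ∙ y , sym (\\-unique refl)
    }
    where
      symbol≡ : ∀ (D : Fin n → Point n k) r i → Hd (D i ∷ʳ (Hd1 (D i) \\ r)) ≡ r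
      symbol≡ D r i = trans (Hd≡Hd1∙last (D i) _) (∙-\\ (Hd1 (D i)) r)

      preserves : ∀ {D} → IsTransversal Hd1 D → ∀ r →
                  IsConstantDiagonal Hd (λ i → D i ∷ʳ (Hd1 (D i) \\ r))
      preserves {D} transversal r =
        ∷ʳ-isDiagonal {D = D} (proj₁ transversal)
                      (transversal-symbols-injective {H = Hd1} {D = D} transversal ∘ \\-injectiveˡ r) ,
        λ i j → trans (symbol≡ D r i) (sym (symbol≡ D r j))

theorem3p11 : (n k : ℕ) → 1 ≤ k →
    (_*_ : Fin n → Fin n → Fin n) → IsQuasigroup _*_ →
    (Hd : Hypercube n (suc k)) (Hd1 : Hypercube n k) →
    IsLatin Hd → IsLatin Hd1 →
    ((x : Point n k) (y : Fin n) → Hd (x ∷ʳ y) ≡ Hd1 x * y) →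
    ((EveryEntryIn (IsConstantDiagonal Hd1) → EveryEntryIn (IsTransversal Hd)) ×
     (PartitionInto (IsConstantDiagonal Hd1) → PartitionInto (IsTransversal Hd))) ×
    ((EveryEntryIn (IsTransversal Hd1) → EveryEntryIn (IsConstantDiagonal Hd)) ×
     (PartitionInto (IsTransversal Hd1) → PartitionInto (IsConstantDiagonal Hd)))
theorem3p11 n k _ _*_ Q Hd Hd1 _ _ Hd≡Hd1*last =
  (lift-everyEntryIn constant⇒transversal , lift-partitionInto constant⇒transversal) ,
  (lift-everyEntryIn transversal⇒constant , lift-partitionInto transversal⇒constant)
  where
    constant⇒transversal : Lifting (IsConstantDiagonal Hd1) (IsTransversal Hd)
    constant⇒transversal = constantDiagonal⇒transversal Q Hd Hd1 Hd≡Hd1*last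

    transversal⇒constant : Lifting (IsTransversal Hd1) (IsConstantDiagonal Hd)
    transversal⇒constant = transversal⇒constantDiagonal Q Hd Hd1 Hd≡Hd1*last
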